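{- Let $D\ge2$, $N\in\{2D,2D+1\}$, and let $\Gamma$, $V$, $\Lambda$, $A^{*(r)}$, $\theta^*_i$ and $P_{h,i,j}$ be as in the context. Then $\{P_{h,i,j}\neq \mathbf{0} : h,i,j\in\{0,1,\dots,D\}\}$ is a basis of $\Lambda$. Moreover, for all $h,i,j\in\{0,1,\dots,D\}$, \[ A^{*(1)}P_{h,i,j}=\theta^*_hP_{h,i,j},\quad A^{*(2)}P_{h,i,j}=\theta^*_iP_{h,i,j},\quad A^{*(3)}P_{h,i,j}=\theta^*_jP_{h,i,j}. \]
   Context: $\Gamma$ is the cycle graph on $X=\{0,\dots,N-1\}=\mathbb{Z}/N\mathbb{Z}$, with $x\sim y$ iff $x-y\equiv\pm1 \pmod N$. Its distance is $\partial(x,y)=\min\{r,N-r\}$ with $r\equiv x-y \pmod N$, $0\le r<N$, and its diameter is $D$. Fix a primitive $N$-th root of unity $\zeta$ and set $\theta_i=\theta^*_i=\zeta^i+\zeta^{ -i}$ for $0\le i\le D$. $V$ is the complex vector space with orthonormal basis $X$, and $A_1x=(x-1)+(x+1)$. On $V^{\otimes3}$ let $A^{(1)}=A_1\otimes I\otimes I$, $A^{(2)}=I\otimes A_1\otimes I$ and $A^{(3)}=I\otimes I\otimes A_1$. Let $A^{*(1)},A^{*(2)},A^{*(3)}$ be the diagonal maps multiplying $x\otimes y\otimes z$ by $\theta^*_{\partial(y,z)}$, $\theta^*_{\partial(x,z)}$ and $\theta^*_{\partial(x,y)}$ respectively. $\Lambda$ (the fundamental module) is the smallest subspace of $V^{\otimes3}$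 that contains $\mathbf{1}^{\otimes3}=\sum_{x,y,z\in X}x\otimes y\otimes z$ and is invariant under these six maps. It is the unique irreducible submodule containing $\mathbf 1^{\otimes 3}$ for the associated $S_3$-symmetric tridiagonal algebra. For $h,i,j\in\{0,\dots,D\}$, $P_{h,i,j}=\sum x\otimes y\otimes z$, where the sum is over all $x,y,z\in X$ with $\partial(y,z)=h$, $\partial(x,z)=i$ and $\partial(x,y)=j$. -}

module Defs where

open import Level using (Level; _⊔_)
open import Data.Nat as ℕ using (ℕ; zero; suc; _∸_; _⊓_; _≤ᵇ_; _≡ᵇ_)
open import Data.Fin using (Fin; toℕ)
open import Data.Bool using (Bool; true; false; if_then_else_; _∧_; _∨_)
open import Data.Product using (Σ; ∃; _×_; _,_)
open import Relation.Nullary using (¬_)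
open import Algebra.Bundles using (CommutativeRing; Semiring)

IsField : ∀ {c ℓ} → CommutativeRing c ℓ → Set (c ⊔ ℓ)
IsField F = (¬ (0# ≈ 1#)) × (∀ x → ¬ (x ≈ 0#) → ∃ λ y → x * y ≈ 1#)
  where open CommutativeRing F

CharZero : ∀ {c ℓ} → CommutativeRing c ℓ → Set ℓ
CharZero F = ∀ n → ¬ (suc n ×ᴿ 1# ≈ 0#)
  where open CommutativeRing F
        open import Algebra.Definitions.RawSemiring (Semiring.rawSemiring semiring) using () renaming (_×_ to _×ᴿ_)

PrimitiveRoot : ∀ {c ℓ} (F : CommutativeRing c ℓ) → ℕ → CommutativeRing.Carrier F → Set ℓ
PrimitiveRoot F N ζ = (ζ ^ N ≈ 1#) × (∀ k → 0 ℕ.< k → k ℕ.< N → ¬ (ζ ^ k ≈ 1#))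
  where open CommutativeRing F
        open import Algebra.Definitions.RawSemiring (Semiring.rawSemiring semiring) using (_^_)

diffMod : (N : ℕ) → Fin N → Fin N → ℕ
diffMod N x y = if toℕ y ≤ᵇ toℕ x then toℕ x ∸ toℕ y else (toℕ x ℕ.+ N) ∸ toℕ y

dist : (N : ℕ) → Fin N → Fin N → ℕ
dist N x y = diffMod N x y ⊓ (N ∸ diffMod N x y)

adj : (N : ℕ) → Fin N → Fin N → Bool
adj N x y = (diffMod N x y ≡ᵇ 1) ∨ (diffMod N x y ≡ᵇ (N ∸ 1))

-- Linear algebra on V^{⊗3} ≅ functions X³ → F (coordinates w.r.t. the
-- orthonormal basis x ⊗ y ⊗ z)

module Cycle {c ℓ} (F : CommutativeRing c ℓ) (N : ℕ) (ζ : CommutativeRing.Carrier F) where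
  open CommutativeRing F
  open import Algebra.Definitions.RawSemiring (Semiring.rawSemiring semiring) using (_^_)

  ∑ : ∀ {n} → (Fin n → Carrier) → Carrier
  ∑ {zero} f = 0#
  ∑ {suc n} f = f Fin.zero + ∑ (λ i → f (Fin.suc i))
    where import Data.Fin as Fin

  X = Fin N

  V3 : Set c
  V3 = X → X → X → Carrier

  _≋_ : V3 → V3 → Set ℓ
  v ≋ w = ∀ x y z → v x y z ≈ w x y z

  𝟎 : V3
  𝟎 _ _ _ = 0#

  -- 1^{⊗3} = Σ x⊗y⊗z
  𝟏 : V3
  𝟏 _ _ _ = 1#

  _⊕_ : V3 → V3 → V3
  (v ⊕ w) x y z = v x y z + w x y z

  _⊛_ : Carrier → V3 → V3
  (a ⊛ v) x y z = a * v x y z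

  [_] : Bool → Carrier
  [ b ] = if b then 1# else 0#

  A1⁽¹⁾ A1⁽²⁾ A1⁽³⁾ : V3 → V3
  A1⁽¹⁾ v x y z = ∑ λ x' → [ adj N x x' ] * v x' y z
  A1⁽²⁾ v x y z = ∑ λ y' → [ adj N y y' ] * v x y' z
  A1⁽³⁾ v x y z = ∑ λ z' → [ adj N z z' ] * v x y z'

  -- θ*_i = ζ^i + ζ^{-i}  (ζ^{-i} = ζ^{N-i} since ζ^N = 1, 0 ≤ i ≤ D < N)
  θ* : ℕ → Carrier
  θ* i = ζ ^ i + ζ ^ (N ∸ i)

  A*⁽¹⁾ A*⁽²⁾ A*⁽³⁾ : V3 → V3
  A*⁽¹⁾ v x y z = θ* (dist N y z) * v x y z
  A*⁽²⁾ v x y z = θ* (dist N x z) * v x y z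
  A*⁽³⁾ v x y z = θ* (dist N x y) * v x y z

  -- Λ: the smallest subspace containing 1^{⊗3} and invariant under the
  -- six maps (inductively generated; closed under ≋)
  data Λ : V3 → Set (c ⊔ ℓ) where
    Λ-𝟏   : Λ 𝟏
    Λ-𝟎   : Λ 𝟎
    Λ-⊕   : ∀ {v w} → Λ v → Λ w → Λ (v ⊕ w)
    Λ-⊛   : ∀ a {v} → Λ v → Λ (a ⊛ v)
    Λ-A1⁽¹⁾ : ∀ {v} → Λ v → Λ (A1⁽¹⁾ v)
    Λ-A1⁽²⁾ : ∀ {v} → Λ v → Λ (A1⁽²⁾ v)
    Λ-A1⁽³⁾ : ∀ {v} → Λ v → Λ (A1⁽³⁾ v)
    Λ-A*⁽¹⁾ : ∀ {v} → Λ v → Λ (A*⁽¹⁾ v)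
    Λ-A*⁽²⁾ : ∀ {v} → Λ v → Λ (A*⁽²⁾ v)
    Λ-A*⁽³⁾ : ∀ {v} → Λ v → Λ (A*⁽³⁾ v)
    Λ-resp  : ∀ {v w} → v ≋ w → Λ v → Λ w

  P : ℕ → ℕ → ℕ → V3
  P h i j x y z = [ (dist N y z ≡ᵇ h) ∧ (dist N x z ≡ᵇ i) ∧ (dist N x y ≡ᵇ j) ]

  module _ (D : ℕ) where
    I = Fin (suc D)

    combo : (I → I → I → Carrier) → V3
    combo co x y z = ∑ λ h → ∑ λ i → ∑ λ j → co h i j * P (toℕ h) (toℕ i) (toℕ j) x y z

    -- {P_{h,i,j} ≠ 0 : h,i,j ∈ {0..D}} is a basis of Λ:
    --  (1) each nonzero P_{hij} lies in Λ,
    --  (2) they span Λ (zero P's contribute nothing to a combination),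
    --  (3) they are linearly independent.
    IsBasisOfΛ : Set (c ⊔ ℓ)
    IsBasisOfΛ =
      (∀ (h i j : I) → ¬ (P (toℕ h) (toℕ i) (toℕ j) ≋ 𝟎) → Λ (P (toℕ h) (toℕ i) (toℕ j)))
      × (∀ v → Λ v → ∃ λ (co : I → I → I → Carrier) → v ≋ combo co)
      × (∀ (co : I → I → I → Carrier) → combo co ≋ 𝟎 →
           ∀ (h i j : I) → ¬ (P (toℕ h) (toℕ i) (toℕ j) ≋ 𝟎) → co h i j ≈ 0#)

{-# OPTIONS --safe #-}
module Submission where

-- P_{h,i,j} is the indicator vector of the triples with distance profile (h,i,j), so these vectors
-- are common eigenvectors of the A*⁽ʳ⁾ and the nonzero ones are linearly independent.
-- Since ζ is a primitive N-th root of unity and 2D ≤ N, the eigenvalues θ*_0, …, θ*_D are distinct,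
-- so a Lagrange polynomial in A*⁽ʳ⁾ projects onto each of its eigenspaces; applying three such
-- projections to 1^{⊗3} puts every P_{h,i,j} in Λ.
-- Conversely, the maps x ↦ ±x + c of ℤ/Nℤ preserve distances and commute with the adjacency maps, so
-- every vector of Λ is invariant under them; since the three pairwise distances of a triple on the
-- cycle determine it up to such a map, every vector of Λ is constant on distance profiles, hence a
-- combination of the P_{h,i,j}.

open import Data.Nat using (ℕ; NonZero)
open import Algebra.Bundles using (CommutativeRing)
open import Defs

module Integers where
  open import Data.Nat using (_∸_; _≤_)
  open import Data.Integer using (ℤ; +_; _+_; -_; _-_)
  import Data.Integer.Properties as ℤ
  open import Data.Sign as Sign using (Sign; opposite)
  open import Relation.Binary.PropositionalEquality using (_≡_; refl; sym; trans; cong)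

  pos-∸ : ∀ {m n} → n ≤ m → + (m ∸ n) ≡ + m - + n
  pos-∸ {m} {n} n≤m = trans (sym (ℤ.⊖-≥ n≤m)) (sym (ℤ.m-n≡m⊖n m n))

  infixr 8 _·_
  _·_ : Sign → ℤ → ℤ
  Sign.+ · s = s
  Sign.- · s = - s

  opposite-· : ∀ ε s → opposite ε · s ≡ - (ε · s)
  opposite-· Sign.+ s = refl
  opposite-· Sign.- s = sym (ℤ.neg-involutive s)

  ·-neg : ∀ ε s → ε · (- s) ≡ opposite ε · s
  ·-neg Sign.+ s = refl
  ·-neg Sign.- s = ℤ.neg-involutive s

  ·-involutive : ∀ ε s → ε · ε · s ≡ s
  ·-involutive Sign.+ s = refl
  ·-involutive Sign.- s = ℤ.neg-involutive s

  *-· : ∀ ε η s → (ε Sign.* η) · s ≡ ε · η · s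
  *-· Sign.+ η s = refl
  *-· Sign.- η s = opposite-· η s

  ·-distrib-+ : ∀ ε s t → ε · (s + t) ≡ ε · s + ε · t
  ·-distrib-+ Sign.+ s t = refl
  ·-distrib-+ Sign.- s t = ℤ.neg-distrib-+ s t

  ·-distrib-minus : ∀ ε s t → ε · (s - t) ≡ ε · s - ε · t
  ·-distrib-minus ε s t = trans (·-distrib-+ ε s (- t)) (cong (_+_ (ε · s)) (trans (·-neg ε t) (opposite-· ε t)))

module Modular (N : ℕ) .{{_ : NonZero N}} where
  open import Data.Nat as ℕ using (ℕ; zero; suc; _∸_; _⊓_; _≤_; _<_)
  import Data.Nat.Properties as ℕ
  open import Data.Integer as ℤ using (ℤ; +_; -[1+_]; +[1+_]; _+_; _*_; -_; _-_; 0ℤ; 1ℤ)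
  import Data.Integer.Properties as ℤ
  open import Data.Integer.DivMod using (_%ℕ_; _/ℕ_; n%ℕd<d; a≡a%ℕn+[a/ℕn]*n)
  open import Data.Integer.Tactic.RingSolver using (solve-∀)
  open import Data.Sign as Sign using (opposite)
  open import Data.Product using (∃; _×_; _,_)
  open import Data.Sum using (inj₁; inj₂)
  open import Data.Empty using (⊥-elim)
  open import Function using (_∘_)
  open import Relation.Binary using (IsEquivalence; Setoid)
  import Relation.Binary.Reasoning.Setoid
  open import Relation.Binary.PropositionalEquality
  open import Relation.Nullary using (yes; no)
  open Integers

  infix 4 _≡ₙ_
  record _≡ₙ_ (s t : ℤ) : Set where
    constructor congruent
    field
      quotient : ℤ
      equality : s ≡ t + quotient * + N

  ≡⇒≡ₙ : ∀ {s t} → s ≡ t → s ≡ₙ t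
  ≡⇒≡ₙ {s} refl = congruent 0ℤ (identity s (+ N))
    where identity : ∀ s n → s ≡ s + 0ℤ * n
          identity = solve-∀

  ≡ₙ-refl : ∀ {s} → s ≡ₙ s
  ≡ₙ-refl = ≡⇒≡ₙ refl

  ≡ₙ-sym : ∀ {s t} → s ≡ₙ t → t ≡ₙ s
  ≡ₙ-sym {t = t} (congruent k eq) = congruent (- k) (trans (identity t k (+ N)) (cong (_+ - k * + N) (sym eq)))
    where identity : ∀ t k n → t ≡ t + k * n + - k * n
          identity = solve-∀

  ≡ₙ-trans : ∀ {s t u} → s ≡ₙ t → t ≡ₙ u → s ≡ₙ u
  ≡ₙ-trans {u = u} (congruent k refl) (congruent l refl) = congruent (l + k) (identity u k l (+ N))
    where identity : ∀ u k l n → u + l * n + k * n ≡ u + (l + k) * n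
          identity = solve-∀

  ≡ₙ-isEquivalence : IsEquivalence _≡ₙ_
  ≡ₙ-isEquivalence = record { refl = ≡ₙ-refl ; sym = ≡ₙ-sym ; trans = ≡ₙ-trans }

  ≡ₙ-setoid : Setoid _ _
  ≡ₙ-setoid = record { isEquivalence = ≡ₙ-isEquivalence }

  +-cong-≡ₙ : ∀ {s t s′ t′} → s ≡ₙ t → s′ ≡ₙ t′ → s + s′ ≡ₙ t + t′
  +-cong-≡ₙ {t = t} {t′ = t′} (congruent k refl) (congruent l refl) = congruent (k + l) (identity t t′ k l (+ N))
    where identity : ∀ t t′ k l n → t + k * n + (t′ + l * n) ≡ t + t′ + (k + l) * n
          identity = solve-∀

  neg-cong-≡ₙ : ∀ {s t} → s ≡ₙ t → - s ≡ₙ - t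
  neg-cong-≡ₙ {t = t} (congruent k refl) = congruent (- k) (identity t k (+ N))
    where identity : ∀ t k n → - (t + k * n) ≡ - t + - k * n
          identity = solve-∀

  N≡ₙ0 : + N ≡ₙ 0ℤ
  N≡ₙ0 = congruent 1ℤ (identity (+ N))
    where identity : ∀ n → n ≡ 0ℤ + 1ℤ * n
          identity = solve-∀

  ·-cong-≡ₙ : ∀ ε {s t} → s ≡ₙ t → ε · s ≡ₙ ε · t
  ·-cong-≡ₙ Sign.+ eq = eq
  ·-cong-≡ₙ Sign.- eq = neg-cong-≡ₙ eq

  module ≡ₙ-Reasoning = Relation.Binary.Reasoning.Setoid ≡ₙ-setoid

  +-cancelˡ-≡ₙ : ∀ u {s t} → u + s ≡ₙ u + t → s ≡ₙ t
  +-cancelˡ-≡ₙ u {s} {t} eq = begin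
    s               ≡⟨ identity u s ⟩
    - u + (u + s)   ≈⟨ +-cong-≡ₙ (≡ₙ-refl { - u}) eq ⟩
    - u + (u + t)   ≡⟨ identity u t ⟨
    t               ∎
    where
    open ≡ₙ-Reasoning
    identity : ∀ u s → s ≡ - u + (u + s)
    identity = solve-∀

  residue : ℤ → ℕ
  residue s = s %ℕ N

  residue<N : ∀ s → residue s < N
  residue<N s = n%ℕd<d s N

  ≡ₙ-residue : ∀ s → s ≡ₙ + residue s
  ≡ₙ-residue s = congruent (s /ℕ N) (a≡a%ℕn+[a/ℕn]*n s N)

  private
    no-wraparound : ∀ {r r′ n} → r < N → + r ≢ + r′ + +[1+ n ] * + N
    no-wraparound {r} {r′} {n} r<N eq = ℕ.<⇒≱ r<N (begin
      N                  ≤⟨ ℕ.m≤m+n N (n ℕ.* N) ⟩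
      suc n ℕ.* N        ≤⟨ ℕ.m≤n+m (suc n ℕ.* N) r′ ⟩
      r′ ℕ.+ suc n ℕ.* N ≡⟨ ℤ.+-injective wrapped ⟩
      r                  ∎)
      where
      open ℕ.≤-Reasoning
      wrapped : + (r′ ℕ.+ suc n ℕ.* N) ≡ + r
      wrapped = trans (ℤ.pos-+ r′ (suc n ℕ.* N)) (trans (cong (_+_ (+ r′)) (ℤ.pos-* (suc n) N)) (sym eq))

  residue-unique : ∀ {r r′} → r < N → r′ < N → + r ≡ₙ + r′ → r ≡ r′
  residue-unique {r′ = r′} _ _ (congruent (+ zero) eq) = ℤ.+-injective (trans eq (ℤ.+-identityʳ (+ r′)))
  residue-unique r<N _ (congruent +[1+ n ] eq) = ⊥-elim (no-wraparound {n = n} r<N eq)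
  residue-unique _ r′<N r≡r′@(congruent -[1+ n ] _) =
    ⊥-elim (no-wraparound {n = n} r′<N (_≡ₙ_.equality (≡ₙ-sym r≡r′)))

  residue-of : ∀ {s r} → r < N → s ≡ₙ + r → residue s ≡ r
  residue-of {s} r<N eq = residue-unique (residue<N s) r<N (≡ₙ-trans (≡ₙ-sym (≡ₙ-residue s)) eq)

  residue-cong : ∀ {s t} → s ≡ₙ t → residue s ≡ residue t
  residue-cong {t = t} eq = residue-of (residue<N t) (≡ₙ-trans eq (≡ₙ-residue t))

  infix 10 ‖_‖
  ‖_‖ : ℤ → ℕ
  ‖ s ‖ = residue s ⊓ (N ∸ residue s)

  ‖‖-cong : ∀ {s t} → s ≡ₙ t → ‖ s ‖ ≡ ‖ t ‖
  ‖‖-cong eq = cong (λ r → r ⊓ (N ∸ r)) (residue-cong eq)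

  ∸-≡ₙ : ∀ {r} → r ≤ N → + (N ∸ r) ≡ₙ - + r
  ∸-≡ₙ {r} r≤N = begin
    + (N ∸ r)     ≡⟨ pos-∸ r≤N ⟩
    + N - + r     ≈⟨ +-cong-≡ₙ N≡ₙ0 (≡ₙ-refl { - + r}) ⟩
    0ℤ - + r      ≡⟨ ℤ.+-identityˡ (- + r) ⟩
    - + r         ∎
    where open ≡ₙ-Reasoning

  ‖‖-of : ∀ {s r} → r ≤ N → s ≡ₙ + r → ‖ s ‖ ≡ r ⊓ (N ∸ r)
  ‖‖-of {s} {r} r≤N eq with ℕ.m≤n⇒m<n∨m≡n r≤N
  ... | inj₁ r<N = cong (λ r → r ⊓ (N ∸ r)) (residue-of r<N eq)
  ... | inj₂ refl = begin
    ‖ s ‖          ≡⟨ cong (λ r → r ⊓ (N ∸ r)) (residue-of (ℕ.>-nonZero⁻¹ N) (≡ₙ-trans eq N≡ₙ0)) ⟩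
    0              ≡⟨ ℕ.⊓-zeroʳ N ⟨
    N ⊓ 0          ≡⟨ cong (N ⊓_) (ℕ.n∸n≡0 N) ⟨
    N ⊓ (N ∸ N)    ∎
    where open ≡-Reasoning

  ‖-‖ : ∀ s → ‖ - s ‖ ≡ ‖ s ‖
  ‖-‖ s = begin
    ‖ - s ‖                  ≡⟨ ‖‖-of (ℕ.m∸n≤m N r) -s≡N∸r ⟩
    (N ∸ r) ⊓ (N ∸ (N ∸ r))  ≡⟨ cong ((N ∸ r) ⊓_) (ℕ.m∸[m∸n]≡n r≤N) ⟩
    (N ∸ r) ⊓ r              ≡⟨ ℕ.⊓-comm (N ∸ r) r ⟩
    ‖ s ‖                    ∎
    where
    open ≡-Reasoning
    r = residue s
    r≤N = ℕ.<⇒≤ (residue<N s)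
    -s≡N∸r = ≡ₙ-trans (neg-cong-≡ₙ (≡ₙ-residue s)) (≡ₙ-sym (∸-≡ₙ r≤N))

  ‖·‖ : ∀ ε s → ‖ ε · s ‖ ≡ ‖ s ‖
  ‖·‖ Sign.+ s = refl
  ‖·‖ Sign.- s = ‖-‖ s

  ≡ₙ-±‖‖ : ∀ s → ∃ λ ε → s ≡ₙ ε · + ‖ s ‖
  ≡ₙ-±‖‖ s with ℕ.⊓-sel (residue s) (N ∸ residue s)
  ... | inj₁ ‖s‖≡r = Sign.+ , ≡ₙ-trans (≡ₙ-residue s) (≡⇒≡ₙ (cong +_ (sym ‖s‖≡r)))
  ... | inj₂ ‖s‖≡N∸r = Sign.- , (begin
    s              ≈⟨ ≡ₙ-residue s ⟩
    + r            ≡⟨ ℤ.neg-involutive (+ r) ⟨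
    - - + r        ≈⟨ neg-cong-≡ₙ (∸-≡ₙ (ℕ.<⇒≤ (residue<N s))) ⟨
    - + (N ∸ r)    ≡⟨ cong (-_ ∘ +_) ‖s‖≡N∸r ⟨
    - + ‖ s ‖      ∎)
    where
    open ≡ₙ-Reasoning
    r = residue s

  ‖‖-injective : ∀ {s t} → ‖ s ‖ ≡ ‖ t ‖ → ∃ λ ε → t ≡ₙ ε · s
  ‖‖-injective {s} {t} ‖s‖≡‖t‖ with ≡ₙ-±‖‖ s | ≡ₙ-±‖‖ t
  ... | ε , s≡ | η , t≡ = η Sign.* ε , (begin
    t                  ≈⟨ t≡ ⟩
    η · + ‖ t ‖        ≡⟨ cong (λ m → η · + m) ‖s‖≡‖t‖ ⟨
    η · + ‖ s ‖        ≡⟨ cong (η ·_) (·-involutive ε (+ ‖ s ‖)) ⟨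
    η · ε · ε · + ‖ s ‖ ≈⟨ ·-cong-≡ₙ η (·-cong-≡ₙ ε s≡) ⟨
    η · ε · s          ≡⟨ *-· η ε s ⟨
    (η Sign.* ε) · s   ∎)
    where open ≡ₙ-Reasoning

  ‖‖≤ : ∀ {D} → N ≤ suc (2 ℕ.* D) → ∀ s → ‖ s ‖ ≤ D
  ‖‖≤ {D} N≤ s with residue s ℕ.≤? D
  ... | yes r≤D = ℕ.≤-trans (ℕ.m⊓n≤m _ _) r≤D
  ... | no r≰D = ℕ.≤-trans (ℕ.m⊓n≤n (residue s) _) (ℕ.m≤n+o⇒m∸n≤o N (residue s) (begin
    N                      ≤⟨ N≤ ⟩
    suc (D ℕ.+ (D ℕ.+ 0))  ≡⟨ cong (λ m → suc (D ℕ.+ m)) (ℕ.+-identityʳ D) ⟩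
    suc D ℕ.+ D            ≤⟨ ℕ.+-monoˡ-≤ D (ℕ.≰⇒> r≰D) ⟩
    residue s ℕ.+ D        ∎))
    where open ℕ.≤-Reasoning

  private
    opposed-difference : ∀ ε {a b a′ b′} → a′ ≡ₙ ε · a → b′ ≡ₙ opposite ε · b → b′ - a′ ≡ₙ - (ε · (b + a))
    opposed-difference ε {a} {b} {a′} {b′} a′≡ b′≡ = begin
      b′ - a′                   ≈⟨ +-cong-≡ₙ b′≡ (neg-cong-≡ₙ a′≡) ⟩
      opposite ε · b - ε · a    ≡⟨ cong (_- ε · a) (opposite-· ε b) ⟩
      - (ε · b) - ε · a         ≡⟨ ℤ.neg-distrib-+ (ε · b) (ε · a) ⟨
      - (ε · b + ε · a)         ≡⟨ cong -_ (·-distrib-+ ε b a) ⟨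
      - (ε · (b + a))           ∎
      where open ≡ₙ-Reasoning

    -- With opposite signs ‖ b - a ‖ = ‖ b + a ‖, which forces a ≡ₙ - a or b ≡ₙ - b, so one of the
    -- two signs may be flipped.
    opposed : ∀ ε {a b a′ b′} → a′ ≡ₙ ε · a → b′ ≡ₙ opposite ε · b → ‖ b - a ‖ ≡ ‖ b′ - a′ ‖ →
              ∃ λ η → a′ ≡ₙ η · a × b′ ≡ₙ η · b
    opposed ε {a} {b} {a′} {b′} a′≡ b′≡ ‖b-a‖≡ = resolve (‖‖-injective {b - a} {b + a} ‖b-a‖≡‖b+a‖)
      where
      ‖b-a‖≡‖b+a‖ : ‖ b - a ‖ ≡ ‖ b + a ‖
      ‖b-a‖≡‖b+a‖ = begin
        ‖ b - a ‖                 ≡⟨ ‖b-a‖≡ ⟩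
        ‖ b′ - a′ ‖               ≡⟨ ‖‖-cong (opposed-difference ε {a} {b} {a′} {b′} a′≡ b′≡) ⟩
        ‖ - (ε · (b + a)) ‖       ≡⟨ ‖-‖ (ε · (b + a)) ⟩
        ‖ ε · (b + a) ‖           ≡⟨ ‖·‖ ε (b + a) ⟩
        ‖ b + a ‖                 ∎
        where open ≡-Reasoning
      identity : ∀ a b → - (b - a) ≡ a + - b
      identity = solve-∀
      resolve : (∃ λ η → b + a ≡ₙ η · (b - a)) → ∃ λ η → a′ ≡ₙ η · a × b′ ≡ₙ η · b
      resolve (Sign.+ , b+a≡b-a) =
        opposite ε , ≡ₙ-trans a′≡ (≡ₙ-trans (·-cong-≡ₙ ε a≡-a) (≡⇒≡ₙ (·-neg ε a))) , b′≡
        where a≡-a : a ≡ₙ - a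
              a≡-a = +-cancelˡ-≡ₙ b b+a≡b-a
      resolve (Sign.- , b+a≡a-b) =
        ε , a′≡ , ≡ₙ-trans b′≡ (≡ₙ-trans (≡⇒≡ₙ (sym (·-neg ε b))) (·-cong-≡ₙ ε (≡ₙ-sym b≡-b)))
        where b≡-b : b ≡ₙ - b
              b≡-b = +-cancelˡ-≡ₙ a (≡ₙ-trans (≡⇒≡ₙ (ℤ.+-comm a b)) (≡ₙ-trans b+a≡a-b (≡⇒≡ₙ (identity a b))))

  ‖‖-injective₂ : ∀ {a b a′ b′} → ‖ a ‖ ≡ ‖ a′ ‖ → ‖ b ‖ ≡ ‖ b′ ‖ → ‖ b - a ‖ ≡ ‖ b′ - a′ ‖ →
                  ∃ λ ε → a′ ≡ₙ ε · a × b′ ≡ₙ ε · b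
  ‖‖-injective₂ {a} {b} {a′} {b′} ‖a‖≡ ‖b‖≡ ‖b-a‖≡ =
    combine (‖‖-injective {a} {a′} ‖a‖≡) (‖‖-injective {b} {b′} ‖b‖≡)
    where
    combine : (∃ λ ε → a′ ≡ₙ ε · a) → (∃ λ ε → b′ ≡ₙ ε · b) → ∃ λ ε → a′ ≡ₙ ε · a × b′ ≡ₙ ε · b
    combine (Sign.+ , a′≡) (Sign.+ , b′≡) = Sign.+ , a′≡ , b′≡
    combine (Sign.- , a′≡) (Sign.- , b′≡) = Sign.- , a′≡ , b′≡
    combine (Sign.+ , a′≡) (Sign.- , b′≡) = opposed Sign.+ {a} {b} {a′} {b′} a′≡ b′≡ ‖b-a‖≡
    combine (Sign.- , a′≡) (Sign.+ , b′≡) = opposed Sign.- {a} {b} {a′} {b′} a′≡ b′≡ ‖b-a‖≡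

module CycleGeometry (N : ℕ) .{{_ : NonZero N}} where
  open import Data.Nat as ℕ using (ℕ; _∸_; _⊓_; _<_; z≤n; s≤s; _≡ᵇ_; _≤ᵇ_)
  import Data.Nat.Properties as ℕ
  open import Data.Integer as ℤ using (ℤ; +_; _+_; _*_; -_; _-_; 1ℤ)
  import Data.Integer.Properties as ℤ
  open import Data.Integer.Tactic.RingSolver using (solve-∀)
  open import Data.Fin using (Fin; toℕ; fromℕ<)
  open import Data.Fin.Properties using (toℕ-fromℕ<; toℕ-injective; toℕ<n)
  open import Data.Bool using (true; false; _∨_; T)
  open import Data.Bool.Properties using (T-≡; T-∨; ∨-zeroʳ)
  open import Data.Sign as Sign using (Sign)
  open import Data.Product using (∃; ∃₂; _×_; _,_)
  open import Data.Sum using (inj₁; inj₂)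
  open import Function.Bundles using (Equivalence)
  open import Relation.Binary.PropositionalEquality
  open Integers
  open Modular N

  ⟦_⟧ : Fin N → ℤ
  ⟦ x ⟧ = + toℕ x

  fromℤ : ℤ → Fin N
  fromℤ s = fromℕ< (residue<N s)

  ⟦fromℤ⟧ : ∀ s → ⟦ fromℤ s ⟧ ≡ₙ s
  ⟦fromℤ⟧ s = ≡ₙ-trans (≡⇒≡ₙ (cong +_ (toℕ-fromℕ< (residue<N s)))) (≡ₙ-sym (≡ₙ-residue s))

  ⟦⟧-injective : ∀ {x y} → ⟦ x ⟧ ≡ₙ ⟦ y ⟧ → x ≡ y
  ⟦⟧-injective {x} {y} eq = toℕ-injective (residue-unique (toℕ<n x) (toℕ<n y) eq)

  diffMod≡residue : ∀ x y → diffMod N x y ≡ residue (⟦ x ⟧ - ⟦ y ⟧)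
  diffMod≡residue x y with toℕ y ≤ᵇ toℕ x in y≤ᵇx
  ... | true = sym (residue-of (ℕ.≤-<-trans (ℕ.m∸n≤m (toℕ x) (toℕ y)) (toℕ<n x)) (≡⇒≡ₙ (sym (pos-∸ y≤x))))
    where y≤x = ℕ.≤ᵇ⇒≤ (toℕ y) (toℕ x) (subst T (sym y≤ᵇx) _)
  ... | false = sym (residue-of wrapped<N wrapped≡)
    where
    x<y : toℕ x < toℕ y
    x<y = ℕ.≰⇒> (λ y≤x → subst T y≤ᵇx (ℕ.≤⇒≤ᵇ y≤x))
    wrapped<N : (toℕ x ℕ.+ N) ∸ toℕ y < N
    wrapped<N = ℕ.m<n+o⇒m∸n<o (toℕ x ℕ.+ N) (toℕ y) (ℕ.+-monoˡ-< N x<y)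
    identity : ∀ x y n → x - y ≡ (x + n - y) + - 1ℤ * n
    identity = solve-∀
    wrapped≡ : ⟦ x ⟧ - ⟦ y ⟧ ≡ₙ + ((toℕ x ℕ.+ N) ∸ toℕ y)
    wrapped≡ = congruent (- 1ℤ) (trans (identity ⟦ x ⟧ ⟦ y ⟧ (+ N))
      (cong (λ s → s + - 1ℤ * + N) (sym (trans (pos-∸ (ℕ.≤-trans (ℕ.<⇒≤ (toℕ<n y)) (ℕ.m≤n+m N (toℕ x))))
                                              (cong (_- ⟦ y ⟧) (ℤ.pos-+ (toℕ x) N))))))

  dist≡‖‖ : ∀ x y → dist N x y ≡ ‖ ⟦ x ⟧ - ⟦ y ⟧ ‖
  dist≡‖‖ x y = cong (λ r → r ⊓ (N ∸ r)) (diffMod≡residue x y)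

  step : Sign → Fin N → Fin N
  step ε x = fromℤ (⟦ x ⟧ + ε · 1ℤ)

  step-difference : ∀ ε x → ⟦ x ⟧ - ⟦ step ε x ⟧ ≡ₙ - (ε · 1ℤ)
  step-difference ε x = begin
    ⟦ x ⟧ - ⟦ step ε x ⟧        ≈⟨ +-cong-≡ₙ (≡ₙ-refl {⟦ x ⟧}) (neg-cong-≡ₙ (⟦fromℤ⟧ (⟦ x ⟧ + ε · 1ℤ))) ⟩
    ⟦ x ⟧ - (⟦ x ⟧ + ε · 1ℤ)    ≡⟨ identity ⟦ x ⟧ (ε · 1ℤ) ⟩
    - (ε · 1ℤ)                  ∎
    where
    open ≡ₙ-Reasoning
    identity : ∀ x u → x - (x + u) ≡ - u
    identity = solve-∀

  step-unique : ∀ ε {x y} → ⟦ x ⟧ - ⟦ y ⟧ ≡ₙ - (ε · 1ℤ) → y ≡ step ε x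
  step-unique ε {x} {y} eq = ⟦⟧-injective (begin
    ⟦ y ⟧                    ≡⟨ identity ⟦ x ⟧ ⟦ y ⟧ ⟩
    ⟦ x ⟧ - (⟦ x ⟧ - ⟦ y ⟧)  ≈⟨ +-cong-≡ₙ (≡ₙ-refl {⟦ x ⟧}) (neg-cong-≡ₙ eq) ⟩
    ⟦ x ⟧ - - (ε · 1ℤ)       ≡⟨ cong (_+_ ⟦ x ⟧) (ℤ.neg-involutive (ε · 1ℤ)) ⟩
    ⟦ x ⟧ + ε · 1ℤ           ≈⟨ ⟦fromℤ⟧ (⟦ x ⟧ + ε · 1ℤ) ⟨
    ⟦ step ε x ⟧             ∎)
    where
    open ≡ₙ-Reasoning
    identity : ∀ x y → y ≡ x - (x - y)
    identity = solve-∀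

  adj-residue : ∀ x y → adj N x y ≡ ((residue (⟦ x ⟧ - ⟦ y ⟧) ≡ᵇ 1) ∨ (residue (⟦ x ⟧ - ⟦ y ⟧) ≡ᵇ N ∸ 1))
  adj-residue x y = cong (λ r → (r ≡ᵇ 1) ∨ (r ≡ᵇ N ∸ 1)) (diffMod≡residue x y)

  adj-step : 1 < N → ∀ ε x → adj N x (step ε x) ≡ true
  adj-step 1<N Sign.+ x = begin
    adj N x (step Sign.+ x)                 ≡⟨ adj-residue x (step Sign.+ x) ⟩
    _                                       ≡⟨ cong (λ r → (r ≡ᵇ 1) ∨ (r ≡ᵇ N ∸ 1)) residue≡N∸1 ⟩
    (N ∸ 1 ≡ᵇ 1) ∨ (N ∸ 1 ≡ᵇ N ∸ 1)         ≡⟨ cong ((N ∸ 1 ≡ᵇ 1) ∨_) N∸1≡ᵇN∸1 ⟩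
    (N ∸ 1 ≡ᵇ 1) ∨ true                     ≡⟨ ∨-zeroʳ _ ⟩
    true                                    ∎
    where
    open ≡-Reasoning
    N∸1≡ᵇN∸1 = Equivalence.to T-≡ (ℕ.≡⇒≡ᵇ (N ∸ 1) (N ∸ 1) refl)
    residue≡N∸1 : residue (⟦ x ⟧ - ⟦ step Sign.+ x ⟧) ≡ N ∸ 1
    residue≡N∸1 = residue-of (ℕ.∸-monoʳ-< {N} {1} {0} (s≤s z≤n) (ℕ.<⇒≤ 1<N))
                             (≡ₙ-trans (step-difference Sign.+ x) (≡ₙ-sym (∸-≡ₙ (ℕ.<⇒≤ 1<N))))
  adj-step 1<N Sign.- x = trans (adj-residue x (step Sign.- x))
    (cong (λ r → (r ≡ᵇ 1) ∨ (r ≡ᵇ N ∸ 1)) (residue-of 1<N (step-difference Sign.- x)))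

  adj⇒step : ∀ {x y} → adj N x y ≡ true → ∃ λ ε → y ≡ step ε x
  adj⇒step {x} {y} x∼y with Equivalence.to T-∨ (Equivalence.from T-≡ (trans (sym (adj-residue x y)) x∼y))
  ... | inj₁ r≡ᵇ1 = Sign.- , step-unique Sign.- (≡ₙ-trans x-y≡r (≡⇒≡ₙ (cong +_ (ℕ.≡ᵇ⇒≡ r 1 r≡ᵇ1))))
    where
    r = residue (⟦ x ⟧ - ⟦ y ⟧)
    x-y≡r = ≡ₙ-residue (⟦ x ⟧ - ⟦ y ⟧)
  ... | inj₂ r≡ᵇN∸1 = Sign.+ , step-unique Sign.+
          (≡ₙ-trans x-y≡r (≡ₙ-trans (≡⇒≡ₙ (cong +_ (ℕ.≡ᵇ⇒≡ r (N ∸ 1) r≡ᵇN∸1))) (∸-≡ₙ (ℕ.>-nonZero⁻¹ N))))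
    where
    r = residue (⟦ x ⟧ - ⟦ y ⟧)
    x-y≡r = ≡ₙ-residue (⟦ x ⟧ - ⟦ y ⟧)

  steps-distinct : 2 < N → ∀ x → step Sign.+ x ≢ step Sign.- x
  steps-distinct 2<N x eq = 2≢0 (residue-unique 2<N (ℕ.>-nonZero⁻¹ N) 2≡0)
    where
    2≢0 : 2 ≢ 0
    2≢0 ()
    1≡-1 : 1ℤ ≡ₙ - 1ℤ
    1≡-1 = +-cancelˡ-≡ₙ ⟦ x ⟧
      (≡ₙ-trans (≡ₙ-sym (⟦fromℤ⟧ (⟦ x ⟧ + 1ℤ))) (≡ₙ-trans (≡⇒≡ₙ (cong ⟦_⟧ eq)) (⟦fromℤ⟧ (⟦ x ⟧ - 1ℤ))))
    2≡0 : + 2 ≡ₙ + 0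
    2≡0 = +-cong-≡ₙ (≡ₙ-refl {1ℤ}) 1≡-1

  dihedral : Sign → ℤ → Fin N → Fin N
  dihedral ε c x = fromℤ (ε · ⟦ x ⟧ + c)

  dist-dihedral : ∀ ε c x y → dist N (dihedral ε c x) (dihedral ε c y) ≡ dist N x y
  dist-dihedral ε c x y = begin
    dist N (dihedral ε c x) (dihedral ε c y)  ≡⟨ dist≡‖‖ (dihedral ε c x) (dihedral ε c y) ⟩
    ‖ ⟦ dihedral ε c x ⟧ - ⟦ dihedral ε c y ⟧ ‖ ≡⟨ ‖‖-cong σx-σy≡ ⟩
    ‖ (ε · ⟦ x ⟧ + c) - (ε · ⟦ y ⟧ + c) ‖     ≡⟨ cong ‖_‖ (identity (ε · ⟦ x ⟧) (ε · ⟦ y ⟧) c) ⟩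
    ‖ ε · ⟦ x ⟧ - ε · ⟦ y ⟧ ‖                 ≡⟨ cong ‖_‖ (·-distrib-minus ε ⟦ x ⟧ ⟦ y ⟧) ⟨
    ‖ ε · (⟦ x ⟧ - ⟦ y ⟧) ‖                   ≡⟨ ‖·‖ ε (⟦ x ⟧ - ⟦ y ⟧) ⟩
    ‖ ⟦ x ⟧ - ⟦ y ⟧ ‖                         ≡⟨ dist≡‖‖ x y ⟨
    dist N x y                                ∎
    where
    open ≡-Reasoning
    identity : ∀ a b c → (a + c) - (b + c) ≡ a - b
    identity = solve-∀
    σx-σy≡ = +-cong-≡ₙ (⟦fromℤ⟧ (ε · ⟦ x ⟧ + c)) (neg-cong-≡ₙ (⟦fromℤ⟧ (ε · ⟦ y ⟧ + c)))

  dihedral-step : ∀ ε c η x → dihedral ε c (step η x) ≡ step (ε Sign.* η) (dihedral ε c x)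
  dihedral-step ε c η x = ⟦⟧-injective (begin
    ⟦ dihedral ε c (step η x) ⟧        ≈⟨ ⟦fromℤ⟧ (ε · ⟦ step η x ⟧ + c) ⟩
    ε · ⟦ step η x ⟧ + c               ≈⟨ +-cong-≡ₙ (·-cong-≡ₙ ε (⟦fromℤ⟧ (⟦ x ⟧ + η · 1ℤ))) (≡ₙ-refl {c}) ⟩
    ε · (⟦ x ⟧ + η · 1ℤ) + c           ≡⟨ cong (_+ c) (·-distrib-+ ε ⟦ x ⟧ (η · 1ℤ)) ⟩
    ε · ⟦ x ⟧ + ε · η · 1ℤ + c         ≡⟨ identity (ε · ⟦ x ⟧) (ε · η · 1ℤ) c ⟩
    (ε · ⟦ x ⟧ + c) + ε · η · 1ℤ       ≡⟨ cong (_+_ (ε · ⟦ x ⟧ + c)) (*-· ε η 1ℤ) ⟨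
    (ε · ⟦ x ⟧ + c) + (ε Sign.* η) · 1ℤ ≈⟨ +-cong-≡ₙ (⟦fromℤ⟧ (ε · ⟦ x ⟧ + c)) (≡ₙ-refl {(ε Sign.* η) · 1ℤ}) ⟨
    ⟦ dihedral ε c x ⟧ + (ε Sign.* η) · 1ℤ ≈⟨ ⟦fromℤ⟧ (⟦ dihedral ε c x ⟧ + (ε Sign.* η) · 1ℤ) ⟨
    ⟦ step (ε Sign.* η) (dihedral ε c x) ⟧ ∎)
    where
    open ≡ₙ-Reasoning
    identity : ∀ a b c → a + b + c ≡ a + c + b
    identity = solve-∀

  dihedral-transitive : ∀ {x y z x′ y′ z′} →
    dist N y z ≡ dist N y′ z′ → dist N x z ≡ dist N x′ z′ → dist N x y ≡ dist N x′ y′ →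
    ∃₂ λ ε c → dihedral ε c x ≡ x′ × dihedral ε c y ≡ y′ × dihedral ε c z ≡ z′
  dihedral-transitive {x} {y} {z} {x′} {y′} {z′} yz xz xy =
    build (‖‖-injective₂ {a} {b} {a′} {b′} ‖a‖≡ ‖b‖≡ ‖b-a‖≡)
    where
    a = ⟦ y ⟧ - ⟦ z ⟧
    b = ⟦ x ⟧ - ⟦ z ⟧
    a′ = ⟦ y′ ⟧ - ⟦ z′ ⟧
    b′ = ⟦ x′ ⟧ - ⟦ z′ ⟧
    ‖‖≡ : ∀ {u v u′ v′} → dist N u v ≡ dist N u′ v′ → ‖ ⟦ u ⟧ - ⟦ v ⟧ ‖ ≡ ‖ ⟦ u′ ⟧ - ⟦ v′ ⟧ ‖
    ‖‖≡ {u} {v} {u′} {v′} eq = trans (sym (dist≡‖‖ u v)) (trans eq (dist≡‖‖ u′ v′))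
    ‖a‖≡ : ‖ a ‖ ≡ ‖ a′ ‖
    ‖a‖≡ = ‖‖≡ {y} {z} {y′} {z′} yz
    ‖b‖≡ : ‖ b ‖ ≡ ‖ b′ ‖
    ‖b‖≡ = ‖‖≡ {x} {z} {x′} {z′} xz
    cancel : ∀ u v w → (u - w) - (v - w) ≡ u - v
    cancel = solve-∀
    ‖b-a‖≡ : ‖ b - a ‖ ≡ ‖ b′ - a′ ‖
    ‖b-a‖≡ = begin
      ‖ b - a ‖           ≡⟨ cong ‖_‖ (cancel ⟦ x ⟧ ⟦ y ⟧ ⟦ z ⟧) ⟩
      ‖ ⟦ x ⟧ - ⟦ y ⟧ ‖   ≡⟨ ‖‖≡ {x} {y} {x′} {y′} xy ⟩
      ‖ ⟦ x′ ⟧ - ⟦ y′ ⟧ ‖ ≡⟨ cong ‖_‖ (cancel ⟦ x′ ⟧ ⟦ y′ ⟧ ⟦ z′ ⟧) ⟨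
      ‖ b′ - a′ ‖         ∎
      where open ≡-Reasoning
    build : (∃ λ ε → a′ ≡ₙ ε · a × b′ ≡ₙ ε · b) →
            ∃₂ λ ε c → dihedral ε c x ≡ x′ × dihedral ε c y ≡ y′ × dihedral ε c z ≡ z′
    build (ε , a′≡ , b′≡) = ε , c , moves b′≡ , moves a′≡ , z↦z′
      where
      -- the map sends z to z′ and scales every offset from z by ε
      c = ⟦ z′ ⟧ - ε · ⟦ z ⟧
      identity : ∀ a b → a + (b - a) ≡ b
      identity = solve-∀
      identity₂ : ∀ a b → a - b + b ≡ a
      identity₂ = solve-∀
      identity₃ : ∀ a b u → a + (u - b) ≡ a - b + u
      identity₃ = solve-∀
      z↦z′ : dihedral ε c z ≡ z′
      z↦z′ = ⟦⟧-injective (≡ₙ-trans (⟦fromℤ⟧ (ε · ⟦ z ⟧ + c)) (≡⇒≡ₙ (identity (ε · ⟦ z ⟧) ⟦ z′ ⟧)))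
      moves : ∀ {w w′} → ⟦ w′ ⟧ - ⟦ z′ ⟧ ≡ₙ ε · (⟦ w ⟧ - ⟦ z ⟧) → dihedral ε c w ≡ w′
      moves {w} {w′} eq = ⟦⟧-injective (begin
        ⟦ dihedral ε c w ⟧             ≈⟨ ⟦fromℤ⟧ (ε · ⟦ w ⟧ + c) ⟩
        ε · ⟦ w ⟧ + c                  ≡⟨ identity₃ (ε · ⟦ w ⟧) (ε · ⟦ z ⟧) ⟦ z′ ⟧ ⟩
        ε · ⟦ w ⟧ - ε · ⟦ z ⟧ + ⟦ z′ ⟧ ≡⟨ cong (_+ ⟦ z′ ⟧) (·-distrib-minus ε ⟦ w ⟧ ⟦ z ⟧) ⟨
        ε · (⟦ w ⟧ - ⟦ z ⟧) + ⟦ z′ ⟧   ≈⟨ +-cong-≡ₙ eq (≡ₙ-refl {⟦ z′ ⟧}) ⟨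
        ⟦ w′ ⟧ - ⟦ z′ ⟧ + ⟦ z′ ⟧       ≡⟨ identity₂ ⟦ w′ ⟧ ⟦ z′ ⟧ ⟩
        ⟦ w′ ⟧                         ∎)
        where open ≡ₙ-Reasoning

module FieldFacts {c ℓ} (F : CommutativeRing c ℓ) (fld : IsField F) where
  open import Data.Product using (_,_; proj₁; proj₂)
  open import Function using (_∘_)
  open import Relation.Nullary using (¬_)
  import Relation.Binary.Reasoning.Setoid as SetoidReasoning
  open CommutativeRing F
  open import Algebra.Properties.Ring ring using ([y-z]x≈yx-zx)
  open import Algebra.Properties.Group +-group using (x∙y⁻¹≈ε⇒x≈y)
  open import Algebra.Solver.CommutativeMonoid +-commutativeMonoid using (solve; _⊕_; _⊜_)
  import Algebra.Solver.Ring.NaturalCoefficients.Default commutativeSemiring as SemiringSolver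
  open SetoidReasoning setoid

  1≉0 : ¬ 1# ≈ 0#
  1≉0 1≈0 = proj₁ fld (sym 1≈0)

  unit-cancelˡ : ∀ {u u⁻¹ y z} → u * u⁻¹ ≈ 1# → u * y ≈ u * z → y ≈ z
  unit-cancelˡ {u} {u⁻¹} {y} {z} uu⁻¹≈1 uy≈uz = begin
    y                ≈⟨ *-identityˡ y ⟨
    1# * y           ≈⟨ *-congʳ uu⁻¹≈1 ⟨
    (u * u⁻¹) * y    ≈⟨ *-congʳ (*-comm u u⁻¹) ⟩
    (u⁻¹ * u) * y    ≈⟨ *-assoc u⁻¹ u y ⟩
    u⁻¹ * (u * y)    ≈⟨ *-congˡ uy≈uz ⟩
    u⁻¹ * (u * z)    ≈⟨ *-assoc u⁻¹ u z ⟨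
    (u⁻¹ * u) * z    ≈⟨ *-congʳ (*-comm u⁻¹ u) ⟩
    (u * u⁻¹) * z    ≈⟨ *-congʳ uu⁻¹≈1 ⟩
    1# * z           ≈⟨ *-identityˡ z ⟩
    z                ∎

  *-nonzero : ∀ {x y} → ¬ x ≈ 0# → ¬ y ≈ 0# → ¬ x * y ≈ 0#
  *-nonzero {x} {y} x≉0 y≉0 xy≈0 with proj₂ fld x x≉0
  ... | x⁻¹ , xx⁻¹≈1 = y≉0 (unit-cancelˡ xx⁻¹≈1 (trans xy≈0 (sym (zeroʳ x))))

  +-exchange : ∀ {x y a b} → x + b ≈ y + a → x - y ≈ a - b
  +-exchange {x} {y} {a} {b} x+b≈y+a = begin
    x - y                    ≈⟨ +-identityʳ (x - y) ⟨
    (x - y) + 0#             ≈⟨ +-congˡ (-‿inverseʳ b) ⟨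
    (x + - y) + (b + - b)    ≈⟨ interchange x (- y) b (- b) ⟩
    (x + b) + (- y + - b)    ≈⟨ +-congʳ x+b≈y+a ⟩
    (y + a) + (- y + - b)    ≈⟨ interchange y a (- y) (- b) ⟩
    (y - y) + (a - b)        ≈⟨ +-congʳ (-‿inverseʳ y) ⟩
    0# + (a - b)             ≈⟨ +-identityˡ (a - b) ⟩
    a - b                    ∎
    where
    interchange : ∀ p q r s → (p + q) + (r + s) ≈ (p + r) + (q + s)
    interchange = solve 4 (λ p q r s → (p ⊕ q) ⊕ (r ⊕ s) ⊜ (p ⊕ r) ⊕ (q ⊕ s)) refl

  inverse-sum-injective : ∀ {a a′ b b′} → a * a′ ≈ 1# → b * b′ ≈ 1# → a + a′ ≈ b + b′ →
                          ¬ a ≈ b → a * b ≈ 1#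
  inverse-sum-injective {a} {a′} {b} {b′} aa′≈1 bb′≈1 a+a′≈b+b′ a≉b
    with proj₂ fld (a - b) (a≉b ∘ x∙y⁻¹≈ε⇒x≈y a b)
  ... | d⁻¹ , dd⁻¹≈1 = unit-cancelˡ dd⁻¹≈1 (begin
    (a - b) * (a * b)             ≈⟨ [y-z]x≈yx-zx (a * b) a b ⟩
    a * (a * b) - b * (a * b)     ≈⟨ +-exchange key ⟩
    a - b                         ≈⟨ *-identityʳ (a - b) ⟨
    (a - b) * 1#                  ∎)
    where
    open SemiringSolver using (_:=_; _:+_; _:*_)
    expand : ∀ a b a′ → a * (a * b) + b * (a * a′) ≈ (a * b) * (a + a′)
    expand = SemiringSolver.solve 3 (λ a b a′ → a :* (a :* b) :+ b :* (a :* a′) := (a :* b) :* (a :+ a′)) refl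
    key : a * (a * b) + b ≈ b * (a * b) + a
    key = begin
      a * (a * b) + b             ≈⟨ +-congˡ (trans (*-congˡ aa′≈1) (*-identityʳ b)) ⟨
      a * (a * b) + b * (a * a′)  ≈⟨ expand a b a′ ⟩
      (a * b) * (a + a′)          ≈⟨ *-congˡ a+a′≈b+b′ ⟩
      (a * b) * (b + b′)          ≈⟨ *-congʳ (*-comm a b) ⟩
      (b * a) * (b + b′)          ≈⟨ expand b a b′ ⟨
      b * (b * a) + a * (b * b′)  ≈⟨ +-cong (*-congˡ (*-comm b a)) (trans (*-congˡ bb′≈1) (*-identityʳ a)) ⟩
      b * (a * b) + a             ∎

module Lagrange {c ℓ} (F : CommutativeRing c ℓ) (θ : ℕ → CommutativeRing.Carrier F) where
  open CommutativeRing F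
  open import Data.Nat as ℕ using (zero; suc; _≤_; _<_; _≡ᵇ_)
  import Data.Nat.Properties as ℕ
  open import Data.Bool using (true; false; if_then_else_; T)
  open import Data.Empty using (⊥-elim)
  open import Data.Sum using (inj₁; inj₂)
  open import Relation.Binary.PropositionalEquality as ≡ using (_≡_; _≢_)
  open import Relation.Nullary using (¬_)
  open import Algebra.Properties.Group +-group using (x∙y⁻¹≈ε⇒x≈y)

  lagrange : ℕ → ℕ → Carrier → Carrier
  lagrange h zero t = 1#
  lagrange h (suc m) t = (if m ≡ᵇ h then 1# else t - θ m) * lagrange h m t

  lagrange-root : ∀ h m {e} → e ≢ h → e < m → lagrange h m (θ e) ≈ 0#
  lagrange-root h (suc m) {e} e≢h e<1+m with ℕ.m<1+n⇒m<n∨m≡n e<1+m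
  ... | inj₁ e<m = trans (*-congˡ (lagrange-root h m e≢h e<m)) (zeroʳ _)
  ... | inj₂ ≡.refl with e ≡ᵇ h in e≡ᵇh
  ...   | true = ⊥-elim (e≢h (ℕ.≡ᵇ⇒≡ e h (≡.subst T (≡.sym e≡ᵇh) _)))
  ...   | false = trans (*-congʳ (-‿inverseʳ (θ e))) (zeroˡ _)

  module _ (fld : IsField F) {D : ℕ} (θ-injective : ∀ {h k} → h ≤ D → k ≤ D → θ h ≈ θ k → h ≡ k) where
    open FieldFacts F fld

    lagrange-nonzero : ∀ h m → h ≤ D → m ≤ suc D → ¬ lagrange h m (θ h) ≈ 0#
    lagrange-nonzero h zero _ _ = 1≉0
    lagrange-nonzero h (suc m) h≤D 1+m≤1+D with m ≡ᵇ h in m≡ᵇh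
    ... | true = *-nonzero 1≉0 (lagrange-nonzero h m h≤D (ℕ.<⇒≤ 1+m≤1+D))
    ... | false = *-nonzero θh-θm≉0 (lagrange-nonzero h m h≤D (ℕ.<⇒≤ 1+m≤1+D))
      where
      θh-θm≉0 : ¬ θ h - θ m ≈ 0#
      θh-θm≉0 θh-θm≈0 with θ-injective h≤D (ℕ.≤-pred 1+m≤1+D) (x∙y⁻¹≈ε⇒x≈y (θ h) (θ m) θh-θm≈0)
      ... | ≡.refl = ≡.subst T m≡ᵇh (ℕ.≡⇒≡ᵇ h h ≡.refl)

module RootsOfUnity {c ℓ} (F : CommutativeRing c ℓ) (fld : IsField F)
                    (N : ℕ) (ζ : CommutativeRing.Carrier F) (prim : PrimitiveRoot F N ζ) where
  open import Data.Nat as ℕ using (_∸_; _≤_; _<_)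
  import Data.Nat.Properties as ℕ
  open import Data.Empty using (⊥-elim)
  open import Data.Product using (proj₁; proj₂)
  open import Function using (_∘_)
  open import Relation.Binary.PropositionalEquality as ≡ using (_≡_)
  open import Relation.Binary.Definitions using (tri<; tri≈; tri>)
  open import Relation.Nullary using (¬_; yes; no)
  import Relation.Binary.Reasoning.Setoid as SetoidReasoning
  open CommutativeRing F
  open FieldFacts F fld
  open import Algebra.Properties.Semiring.Exp semiring using (_^_; ^-homo-*)
  open Cycle F N ζ using (θ*)
  open SetoidReasoning setoid

  ζ^-unit : ∀ {h} → h ≤ N → ζ ^ h * ζ ^ (N ∸ h) ≈ 1#
  ζ^-unit {h} h≤N = begin
    ζ ^ h * ζ ^ (N ∸ h)    ≈⟨ ^-homo-* ζ h (N ∸ h) ⟨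
    ζ ^ (h ℕ.+ (N ∸ h))    ≡⟨ ≡.cong (ζ ^_) (ℕ.m+[n∸m]≡n h≤N) ⟩
    ζ ^ N                  ≈⟨ proj₁ prim ⟩
    1#                     ∎

  private
    ζ^-gap : ∀ {k h} → k < h → h < N → ¬ ζ ^ h ≈ ζ ^ k
    ζ^-gap {k} {h} k<h h<N ζ^h≈ζ^k = proj₂ prim (h ∸ k) (ℕ.m<n⇒0<n∸m k<h) (ℕ.≤-<-trans (ℕ.m∸n≤m h k) h<N)
      (unit-cancelˡ (ζ^-unit (ℕ.<⇒≤ (ℕ.<-trans k<h h<N))) (begin
        ζ ^ k * ζ ^ (h ∸ k)    ≈⟨ ^-homo-* ζ k (h ∸ k) ⟨
        ζ ^ (k ℕ.+ (h ∸ k))    ≡⟨ ≡.cong (ζ ^_) (ℕ.m+[n∸m]≡n (ℕ.<⇒≤ k<h)) ⟩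
        ζ ^ h                  ≈⟨ ζ^h≈ζ^k ⟩
        ζ ^ k                  ≈⟨ *-identityʳ (ζ ^ k) ⟨
        ζ ^ k * 1#             ∎))

  ζ^-injective : ∀ {h k} → h < N → k < N → ζ ^ h ≈ ζ ^ k → h ≡ k
  ζ^-injective {h} {k} h<N k<N ζ^h≈ζ^k with ℕ.<-cmp h k
  ... | tri< h<k _ _ = ⊥-elim (ζ^-gap h<k k<N (sym ζ^h≈ζ^k))
  ... | tri≈ _ h≡k _ = h≡k
  ... | tri> _ _ k<h = ⊥-elim (ζ^-gap k<h h<N ζ^h≈ζ^k)

  θ*-injective : ∀ {D} → 2 ℕ.* D ≤ N → ∀ {h k} → h ≤ D → k ≤ D → θ* h ≈ θ* k → h ≡ k
  θ*-injective {D} 2D≤N {h} {k} h≤D k≤D θ*h≈θ*k with h ℕ.≟ k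
  ... | yes h≡k = h≡k
  ... | no h≢k = ⊥-elim (proj₂ prim (h ℕ.+ k) 0<h+k h+k<N (begin
    ζ ^ (h ℕ.+ k)   ≈⟨ ^-homo-* ζ h k ⟩
    ζ ^ h * ζ ^ k   ≈⟨ inverse-sum-injective (ζ^-unit (ℕ.<⇒≤ h<N)) (ζ^-unit (ℕ.<⇒≤ k<N)) θ*h≈θ*k
                         (h≢k ∘ ζ^-injective h<N k<N) ⟩
    1#              ∎))
    where
    h+k<2D : h ℕ.+ k < D ℕ.+ D
    h+k<2D with ℕ.<-cmp h k
    ... | tri< h<k _ _ = ℕ.+-mono-<-≤ (ℕ.<-≤-trans h<k k≤D) k≤D
    ... | tri≈ _ h≡k _ = ⊥-elim (h≢k h≡k)
    ... | tri> _ _ k<h = ℕ.+-mono-≤-< h≤D (ℕ.<-≤-trans k<h h≤D)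
    h+k<N : h ℕ.+ k < N
    h+k<N = ℕ.<-≤-trans h+k<2D (ℕ.≤-trans (ℕ.≤-reflexive (≡.cong (D ℕ.+_) (≡.sym (ℕ.+-identityʳ D)))) 2D≤N)
    h<N : h < N
    h<N = ℕ.≤-<-trans (ℕ.m≤m+n h k) h+k<N
    k<N : k < N
    k<N = ℕ.≤-<-trans (ℕ.m≤n+m k h) h+k<N
    0<h+k : 0 < h ℕ.+ k
    0<h+k = ℕ.n≢0⇒n>0 (λ h+k≡0 → h≢k (≡.trans (ℕ.m+n≡0⇒m≡0 h h+k≡0) (≡.sym (ℕ.m+n≡0⇒n≡0 h h+k≡0))))


module Fundamental {c ℓ} (F : CommutativeRing c ℓ) (N : ℕ) .{{_ : NonZero N}}
                   (ζ : CommutativeRing.Carrier F) where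
  open import Data.Nat as ℕ using (zero; suc; _<_; _≤_; _≡ᵇ_)
  import Data.Nat.Properties as ℕ
  open import Data.Integer as ℤ using ()
  open import Data.Fin as Fin using (Fin; toℕ; fromℕ<; punchIn; punchOut)
  open import Data.Fin.Properties
    using (punchInᵢ≢i; punchIn-punchOut; punchIn-injective; toℕ-fromℕ<; toℕ-injective; any?)
  open import Data.Bool using (Bool; true; false; _∧_; T; if_then_else_)
  open import Data.Bool.Properties using (T-∧)
  import Data.Sign as Sign
  open import Data.Empty using (⊥-elim)
  open import Data.Product using (∃; ∃₂; _,_; _×_; proj₁; proj₂)
  open import Data.Vec.Functional using (removeAt)
  open import Function using (_∘_)
  open import Function.Bundles using (Equivalence)
  open import Relation.Binary.PropositionalEquality as ≡ using (_≡_; _≢_)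
  open import Relation.Nullary using (¬_; Dec; yes; no)
  open import Relation.Nullary.Decidable using (_×-dec_; decidable-stable)
  import Relation.Binary.Reasoning.Setoid as SetoidReasoning
  open CommutativeRing F
  open Cycle F N ζ
  open CycleGeometry N
  open Lagrange F θ*
  open import Algebra.Properties.CommutativeMonoid.Sum +-commutativeMonoid
    using (sum; sum-cong-≋; sum-replicate-zero; sum-remove)
  open SetoidReasoning setoid

  ∑≡sum : ∀ {n} (f : Fin n → Carrier) → ∑ f ≡ sum f
  ∑≡sum {zero} f = ≡.refl
  ∑≡sum {suc n} f = ≡.cong (f Fin.zero +_) (∑≡sum (f ∘ Fin.suc))

  sum-zero : ∀ {n} {f : Fin n → Carrier} → (∀ k → f k ≈ 0#) → sum f ≈ 0#
  sum-zero {n} f≈0 = trans (sum-cong-≋ f≈0) (sum-replicate-zero n)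

  ∑-zero : ∀ {n} {f : Fin n → Carrier} → (∀ k → f k ≈ 0#) → ∑ f ≈ 0#
  ∑-zero {f = f} f≈0 = trans (reflexive (∑≡sum f)) (sum-zero f≈0)

  sum-single : ∀ {n} {f : Fin n → Carrier} p → (∀ k → k ≢ p → f k ≈ 0#) → sum f ≈ f p
  sum-single {suc n} {f} p vanish = begin
    sum f                   ≈⟨ sum-remove {i = p} f ⟩
    f p + sum (removeAt f p) ≈⟨ +-congˡ (sum-zero (λ k → vanish (punchIn p k) (punchInᵢ≢i p k))) ⟩
    f p + 0#                ≈⟨ +-identityʳ (f p) ⟩
    f p                     ∎

  ∑-single : ∀ {n} {f : Fin n → Carrier} p → (∀ k → k ≢ p → f k ≈ 0#) → ∑ f ≈ f p
  ∑-single {f = f} p vanish = trans (reflexive (∑≡sum f)) (sum-single p vanish)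

  ∑-pair : ∀ {n} {f : Fin n → Carrier} p q → p ≢ q → (∀ k → k ≢ p → k ≢ q → f k ≈ 0#) → ∑ f ≈ f p + f q
  ∑-pair {suc n} {f} p q p≢q vanish = begin
    ∑ f                       ≡⟨ ∑≡sum f ⟩
    sum f                     ≈⟨ sum-remove {i = p} f ⟩
    f p + sum (removeAt f p)   ≈⟨ +-congˡ (sum-single (punchOut p≢q) vanish′) ⟩
    f p + f (punchIn p (punchOut p≢q)) ≡⟨ ≡.cong (λ k → f p + f k) (punchIn-punchOut p≢q) ⟩
    f p + f q                 ∎
    where
    vanish′ : ∀ k → k ≢ punchOut p≢q → f (punchIn p k) ≈ 0#
    vanish′ k k≢ = vanish (punchIn p k) (punchInᵢ≢i p k)
      (λ eq → k≢ (punchIn-injective p k (punchOut p≢q) (≡.trans eq (≡.sym (punchIn-punchOut p≢q)))))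

  ∑³-single : ∀ {l m n} {f : Fin l → Fin m → Fin n → Carrier} p q r →
              (∀ h i j → ¬ (h ≡ p × i ≡ q × j ≡ r) → f h i j ≈ 0#) →
              ∑ (λ h → ∑ λ i → ∑ λ j → f h i j) ≈ f p q r
  ∑³-single {f = f} p q r vanish = begin
    ∑ (λ h → ∑ λ i → ∑ λ j → f h i j)
      ≈⟨ ∑-single p (λ h h≢p → ∑-zero λ i → ∑-zero λ j → vanish h i j (h≢p ∘ proj₁)) ⟩
    ∑ (λ i → ∑ λ j → f p i j)
      ≈⟨ ∑-single q (λ i i≢q → ∑-zero λ j → vanish p i j (i≢q ∘ proj₁ ∘ proj₂)) ⟩
    ∑ (λ j → f p q j)
      ≈⟨ ∑-single r (λ j j≢r → vanish p q j (j≢r ∘ proj₂ ∘ proj₂)) ⟩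
    f p q r
      ∎

  ∑-adj : 2 < N → ∀ x (g : X → Carrier) →
          ∑ (λ y → [ adj N x y ] * g y) ≈ g (step Sign.+ x) + g (step Sign.- x)
  ∑-adj 2<N x g = trans (∑-pair (step Sign.+ x) (step Sign.- x) (steps-distinct 2<N x) vanish)
                        (+-cong (at Sign.+) (at Sign.-))
    where
    at : ∀ ε → [ adj N x (step ε x) ] * g (step ε x) ≈ g (step ε x)
    at ε rewrite adj-step (ℕ.<-trans (ℕ.s≤s (ℕ.s≤s ℕ.z≤n)) 2<N) ε x = *-identityˡ _
    vanish : ∀ y → y ≢ step Sign.+ x → y ≢ step Sign.- x → [ adj N x y ] * g y ≈ 0#
    vanish y y≢+ y≢- with adj N x y in x∼y
    ... | false = zeroˡ (g y)
    ... | true with adj⇒step x∼y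
    ...   | Sign.+ , eq = ⊥-elim (y≢+ eq)
    ...   | Sign.- , eq = ⊥-elim (y≢- eq)

  Invariant : V3 → Set ℓ
  Invariant v = ∀ ε c x y z → v (dihedral ε c x) (dihedral ε c y) (dihedral ε c z) ≈ v x y z

  dihedral-neighbours : ∀ ε c x (f : X → Carrier) →
    f (step Sign.+ (dihedral ε c x)) + f (step Sign.- (dihedral ε c x)) ≈
    f (dihedral ε c (step Sign.+ x)) + f (dihedral ε c (step Sign.- x))
  dihedral-neighbours Sign.+ c x f = reflexive (≡.cong₂ (λ u w → f u + f w)
    (≡.sym (dihedral-step Sign.+ c Sign.+ x)) (≡.sym (dihedral-step Sign.+ c Sign.- x)))
  dihedral-neighbours Sign.- c x f = trans (+-comm _ _) (reflexive (≡.cong₂ (λ u w → f u + f w)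
    (≡.sym (dihedral-step Sign.- c Sign.+ x)) (≡.sym (dihedral-step Sign.- c Sign.- x))))

  ∑-adj-dihedral : 2 < N → ∀ ε c x {f f′ : X → Carrier} → (∀ w → f (dihedral ε c w) ≈ f′ w) →
                   ∑ (λ w → [ adj N (dihedral ε c x) w ] * f w) ≈ ∑ (λ w → [ adj N x w ] * f′ w)
  ∑-adj-dihedral 2<N ε c x {f} {f′} f∘σ≈f′ = begin
    ∑ (λ w → [ adj N (σ x) w ] * f w)             ≈⟨ ∑-adj 2<N (σ x) f ⟩
    f (step Sign.+ (σ x)) + f (step Sign.- (σ x)) ≈⟨ dihedral-neighbours ε c x f ⟩
    f (σ (step Sign.+ x)) + f (σ (step Sign.- x)) ≈⟨ +-cong (f∘σ≈f′ _) (f∘σ≈f′ _) ⟩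
    f′ (step Sign.+ x) + f′ (step Sign.- x)       ≈⟨ ∑-adj 2<N x f′ ⟨
    ∑ (λ w → [ adj N x w ] * f′ w)                ∎
    where σ = dihedral ε c

  Λ⇒Invariant : 2 < N → ∀ {v} → Λ v → Invariant v
  Λ⇒Invariant 2<N Λ-𝟏 ε c x y z = refl
  Λ⇒Invariant 2<N Λ-𝟎 ε c x y z = refl
  Λ⇒Invariant 2<N (Λ-⊕ p q) ε c x y z = +-cong (Λ⇒Invariant 2<N p ε c x y z) (Λ⇒Invariant 2<N q ε c x y z)
  Λ⇒Invariant 2<N (Λ-⊛ a p) ε c x y z = *-congˡ (Λ⇒Invariant 2<N p ε c x y z)
  Λ⇒Invariant 2<N (Λ-A1⁽¹⁾ p) ε c x y z = ∑-adj-dihedral 2<N ε c x (λ w → Λ⇒Invariant 2<N p ε c w y z)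
  Λ⇒Invariant 2<N (Λ-A1⁽²⁾ p) ε c x y z = ∑-adj-dihedral 2<N ε c y (λ w → Λ⇒Invariant 2<N p ε c x w z)
  Λ⇒Invariant 2<N (Λ-A1⁽³⁾ p) ε c x y z = ∑-adj-dihedral 2<N ε c z (λ w → Λ⇒Invariant 2<N p ε c x y w)
  Λ⇒Invariant 2<N (Λ-A*⁽¹⁾ p) ε c x y z =
    *-cong (reflexive (≡.cong θ* (dist-dihedral ε c y z))) (Λ⇒Invariant 2<N p ε c x y z)
  Λ⇒Invariant 2<N (Λ-A*⁽²⁾ p) ε c x y z =
    *-cong (reflexive (≡.cong θ* (dist-dihedral ε c x z))) (Λ⇒Invariant 2<N p ε c x y z)
  Λ⇒Invariant 2<N (Λ-A*⁽³⁾ p) ε c x y z =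
    *-cong (reflexive (≡.cong θ* (dist-dihedral ε c x y))) (Λ⇒Invariant 2<N p ε c x y z)
  Λ⇒Invariant 2<N (Λ-resp v≋w p) ε c x y z =
    trans (sym (v≋w _ _ _)) (trans (Λ⇒Invariant 2<N p ε c x y z) (v≋w x y z))

  lagrangeOp : (V3 → V3) → ℕ → ℕ → V3 → V3
  lagrangeOp A h zero v = v
  lagrangeOp A h (suc m) v = if m ≡ᵇ h then w else A w ⊕ ((- θ* m) ⊛ w)
    where w = lagrangeOp A h m v

  Λ-lagrangeOp : ∀ {A} → (∀ {v} → Λ v → Λ (A v)) → ∀ h m {v} → Λ v → Λ (lagrangeOp A h m v)
  Λ-lagrangeOp Λ-A h zero p = p
  Λ-lagrangeOp Λ-A h (suc m) p with m ≡ᵇ h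
  ... | true = Λ-lagrangeOp Λ-A h m p
  ... | false = Λ-⊕ (Λ-A (Λ-lagrangeOp Λ-A h m p)) (Λ-⊛ _ (Λ-lagrangeOp Λ-A h m p))

  lagrangeOp-diagonal : ∀ {A} (d : X → X → X → ℕ) → (∀ v x y z → A v x y z ≈ θ* (d x y z) * v x y z) →
                        ∀ h m v x y z → lagrangeOp A h m v x y z ≈ lagrange h m (θ* (d x y z)) * v x y z
  lagrangeOp-diagonal d A-diag h zero v x y z = sym (*-identityˡ (v x y z))
  lagrangeOp-diagonal {A} d A-diag h (suc m) v x y z with m ≡ᵇ h
  ... | true = trans (lagrangeOp-diagonal d A-diag h m v x y z) (sym (*-congʳ (*-identityˡ _)))
  ... | false = begin
    A w x y z + (- θ* m) * w x y z       ≈⟨ +-congʳ (A-diag w x y z) ⟩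
    t * w x y z + (- θ* m) * w x y z     ≈⟨ distribʳ (w x y z) t (- θ* m) ⟨
    (t - θ* m) * w x y z                 ≈⟨ *-congˡ (lagrangeOp-diagonal d A-diag h m v x y z) ⟩
    (t - θ* m) * (lagrange h m t * v x y z) ≈⟨ *-assoc _ _ _ ⟨
    (t - θ* m) * lagrange h m t * v x y z ∎
    where
    w = lagrangeOp A h m v
    t = θ* (d x y z)

  restrict : (X → X → X → ℕ) → ℕ → V3 → V3
  restrict d h v x y z = [ d x y z ≡ᵇ h ] * v x y z

  -- Up to the invertible scalar lagrange h (D + 1) (θ* h), lagrangeOp A h (D + 1) is the projection
  -- onto the θ*_h-eigenspace of the diagonal operator A.
  Λ-restrict : IsField F → ∀ {D} → (∀ {h k} → h ≤ D → k ≤ D → θ* h ≈ θ* k → h ≡ k) →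
               ∀ {A} (d : X → X → X → ℕ) → (∀ x y z → d x y z ≤ D) →
               (∀ v x y z → A v x y z ≈ θ* (d x y z) * v x y z) → (∀ {v} → Λ v → Λ (A v)) →
               ∀ {h} → h ≤ D → ∀ {v} → Λ v → Λ (restrict d h v)
  Λ-restrict fld {D} θ*-injective {A} d d≤D A-diag Λ-A {h} h≤D {v} p
    with proj₂ fld (lagrange h (suc D) (θ* h)) (lagrange-nonzero fld θ*-injective h (suc D) h≤D ℕ.≤-refl)
  ... | t , Lt≈1 = Λ-resp projection (Λ-⊛ t (Λ-lagrangeOp Λ-A h (suc D) p))
    where
    L = lagrange h (suc D)
    diagonal = lagrangeOp-diagonal d A-diag h (suc D) v
    projection : (t ⊛ lagrangeOp A h (suc D) v) ≋ restrict d h v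
    projection x y z with d x y z ≡ᵇ h in d≡ᵇh
    ... | true = begin
      t * lagrangeOp A h (suc D) v x y z   ≈⟨ *-congˡ (diagonal x y z) ⟩
      t * (L (θ* (d x y z)) * v x y z)     ≡⟨ ≡.cong (λ e → t * (L (θ* e) * v x y z)) d≡h ⟩
      t * (L (θ* h) * v x y z)             ≈⟨ *-assoc _ _ _ ⟨
      t * L (θ* h) * v x y z               ≈⟨ *-congʳ (trans (*-comm _ _) Lt≈1) ⟩
      1# * v x y z                         ∎
      where d≡h = ℕ.≡ᵇ⇒≡ (d x y z) h (≡.subst T (≡.sym d≡ᵇh) _)
    ... | false = begin
      t * lagrangeOp A h (suc D) v x y z   ≈⟨ *-congˡ (diagonal x y z) ⟩
      t * (L (θ* (d x y z)) * v x y z)     ≈⟨ *-congˡ (*-congʳ (lagrange-root h (suc D) d≢h (ℕ.s≤s (d≤D x y z)))) ⟩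
      t * (0# * v x y z)                   ≈⟨ *-congˡ (zeroˡ _) ⟩
      t * 0#                               ≈⟨ zeroʳ t ⟩
      0#                                   ≈⟨ zeroˡ _ ⟨
      0# * v x y z                         ∎
      where d≢h = λ d≡h → ≡.subst T d≡ᵇh (ℕ.≡⇒≡ᵇ (d x y z) h d≡h)

  [∧] : ∀ a b → [ a ∧ b ] ≈ [ a ] * [ b ]
  [∧] true b = sym (*-identityˡ [ b ])
  [∧] false b = sym (zeroˡ [ b ])

  [_]-support : ∀ b {a a′} → (T b → a ≈ a′) → a * [ b ] ≈ a′ * [ b ]
  [ true ]-support a≈a′ = *-congʳ (a≈a′ _)
  [ false ]-support a≈a′ = trans (zeroʳ _) (sym (zeroʳ _))

  has-profile : ℕ → ℕ → ℕ → X → X → X → Bool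
  has-profile h i j x y z = (dist N y z ≡ᵇ h) ∧ (dist N x z ≡ᵇ i) ∧ (dist N x y ≡ᵇ j)

  has-profile-sound : ∀ h i j x y z → T (has-profile h i j x y z) →
                      dist N y z ≡ h × dist N x z ≡ i × dist N x y ≡ j
  has-profile-sound h i j x y z t with Equivalence.to T-∧ t
  ... | t₁ , t₂₃ with Equivalence.to T-∧ t₂₃
  ...   | t₂ , t₃ = ℕ.≡ᵇ⇒≡ (dist N y z) h t₁ , ℕ.≡ᵇ⇒≡ (dist N x z) i t₂ , ℕ.≡ᵇ⇒≡ (dist N x y) j t₃

  has-profile-complete : ∀ {h i j} x y z → dist N y z ≡ h → dist N x z ≡ i → dist N x y ≡ j →
                         T (has-profile h i j x y z)
  has-profile-complete {h} {i} {j} x y z e₁ e₂ e₃ = Equivalence.from T-∧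
    (ℕ.≡⇒≡ᵇ (dist N y z) h e₁ , Equivalence.from T-∧ (ℕ.≡⇒≡ᵇ (dist N x z) i e₂ , ℕ.≡⇒≡ᵇ (dist N x y) j e₃))

  A*⁽¹⁾-P : ∀ h i j → A*⁽¹⁾ (P h i j) ≋ (θ* h ⊛ P h i j)
  A*⁽¹⁾-P h i j x y z =
    [ has-profile h i j x y z ]-support (reflexive ∘ ≡.cong θ* ∘ proj₁ ∘ has-profile-sound h i j x y z)

  A*⁽²⁾-P : ∀ h i j → A*⁽²⁾ (P h i j) ≋ (θ* i ⊛ P h i j)
  A*⁽²⁾-P h i j x y z =
    [ has-profile h i j x y z ]-support (reflexive ∘ ≡.cong θ* ∘ proj₁ ∘ proj₂ ∘ has-profile-sound h i j x y z)

  A*⁽³⁾-P : ∀ h i j → A*⁽³⁾ (P h i j) ≋ (θ* j ⊛ P h i j)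
  A*⁽³⁾-P h i j x y z =
    [ has-profile h i j x y z ]-support (reflexive ∘ ≡.cong θ* ∘ proj₂ ∘ proj₂ ∘ has-profile-sound h i j x y z)

  Invariant⇒dist-determined : ∀ {v} → Invariant v → ∀ {x y z x′ y′ z′} →
    dist N y z ≡ dist N y′ z′ → dist N x z ≡ dist N x′ z′ → dist N x y ≡ dist N x′ y′ → v x y z ≈ v x′ y′ z′
  Invariant⇒dist-determined {v} inv {x} {y} {z} {x′} {y′} {z′} yz xz xy =
    carry (dihedral-transitive {x} {y} {z} yz xz xy)
    where
    carry : (∃₂ λ ε c → dihedral ε c x ≡ x′ × dihedral ε c y ≡ y′ × dihedral ε c z ≡ z′) →
            v x y z ≈ v x′ y′ z′
    carry (ε , c , e₁ , e₂ , e₃) =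
      trans (sym (inv ε c x y z)) (reflexive (≡.cong₂ (λ a (b , c) → v a b c) e₁ (≡.cong₂ _,_ e₂ e₃)))

  module Profiles (D : ℕ) (N≤2D+1 : N ≤ suc (2 ℕ.* D)) where

    dist≤D : ∀ x y → dist N x y ≤ D
    dist≤D x y = ≡.subst (_≤ D) (≡.sym (dist≡‖‖ x y)) (Modular.‖‖≤ N N≤2D+1 (⟦ x ⟧ ℤ.- ⟦ y ⟧))

    distance : X → X → I D
    distance x y = fromℕ< (ℕ.s≤s (dist≤D x y))

    toℕ-distance : ∀ x y → toℕ (distance x y) ≡ dist N x y
    toℕ-distance x y = toℕ-fromℕ< (ℕ.s≤s (dist≤D x y))

    distance-unique : ∀ x y {h : I D} → dist N x y ≡ toℕ h → h ≡ distance x y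
    distance-unique x y eq = toℕ-injective (≡.trans (≡.sym eq) (≡.sym (toℕ-distance x y)))

    P-on-profile : ∀ x y z → P (toℕ (distance y z)) (toℕ (distance x z)) (toℕ (distance x y)) x y z ≈ 1#
    P-on-profile x y z = [true] (has-profile-complete x y z
      (≡.sym (toℕ-distance y z)) (≡.sym (toℕ-distance x z)) (≡.sym (toℕ-distance x y)))
      where [true] : ∀ {b} → T b → [ b ] ≈ 1#
            [true] {true} _ = refl

    P-off-profile : ∀ x y z (h i j : I D) → ¬ (h ≡ distance y z × i ≡ distance x z × j ≡ distance x y) →
                    P (toℕ h) (toℕ i) (toℕ j) x y z ≈ 0#
    P-off-profile x y z h i j off = [false] λ t → off (profile (has-profile-sound (toℕ h) (toℕ i) (toℕ j) x y z t))
      where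
      [false] : ∀ {b} → ¬ T b → [ b ] ≈ 0#
      [false] {true} ¬t = ⊥-elim (¬t _)
      [false] {false} _ = refl
      profile : dist N y z ≡ toℕ h × dist N x z ≡ toℕ i × dist N x y ≡ toℕ j →
                h ≡ distance y z × i ≡ distance x z × j ≡ distance x y
      profile (e₁ , e₂ , e₃) = distance-unique y z e₁ , distance-unique x z e₂ , distance-unique x y e₃

    combo-at : ∀ co x y z → combo D co x y z ≈ co (distance y z) (distance x z) (distance x y)
    combo-at co x y z = begin
      combo D co x y z                                       ≈⟨ ∑³-single h i j off-profile ⟩
      co h i j * P (toℕ h) (toℕ i) (toℕ j) x y z             ≈⟨ *-congˡ (P-on-profile x y z) ⟩
      co h i j * 1#                                          ≈⟨ *-identityʳ _ ⟩
      co h i j                                               ∎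
      where
      h = distance y z
      i = distance x z
      j = distance x y
      off-profile : ∀ h′ i′ j′ → ¬ (h′ ≡ h × i′ ≡ i × j′ ≡ j) → co h′ i′ j′ * P (toℕ h′) (toℕ i′) (toℕ j′) x y z ≈ 0#
      off-profile h′ i′ j′ off = trans (*-congˡ (P-off-profile x y z h′ i′ j′ off)) (zeroʳ _)

    Realised : I D → I D → I D → Set
    Realised h i j = ∃ λ x → ∃ λ y → ∃ λ z → h ≡ distance y z × i ≡ distance x z × j ≡ distance x y

    realised? : ∀ h i j → Dec (Realised h i j)
    realised? h i j = any? λ x → any? λ y → any? λ z →
      (h Fin.≟ distance y z) ×-dec (i Fin.≟ distance x z) ×-dec (j Fin.≟ distance x y)

    P≉𝟎⇒realised : ∀ h i j → ¬ (P (toℕ h) (toℕ i) (toℕ j) ≋ 𝟎) → Realised h i j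
    P≉𝟎⇒realised h i j P≉𝟎 = decidable-stable (realised? h i j)
      λ ¬realised → P≉𝟎 λ x y z → P-off-profile x y z h i j λ (e₁ , e₂ , e₃) → ¬realised (x , y , z , e₁ , e₂ , e₃)

    value-at : V3 → ∀ {h i j} → Dec (Realised h i j) → Carrier
    value-at v (yes (x , y , z , _)) = v x y z
    value-at v (no _) = 0#

    coefficients : V3 → I D → I D → I D → Carrier
    coefficients v h i j = value-at v (realised? h i j)

    Invariant⇒value-at : ∀ {v} → Invariant v → ∀ x y z (r : Dec (Realised (distance y z) (distance x z) (distance x y))) →
                         v x y z ≈ value-at v r
    Invariant⇒value-at inv x y z (yes (x′ , y′ , z′ , e₁ , e₂ , e₃)) =
      Invariant⇒dist-determined inv {x} {y} {z} {x′} {y′} {z′}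
        (same-dist {y} {z} {y′} {z′} e₁) (same-dist {x} {z} {x′} {z′} e₂) (same-dist {x} {y} {x′} {y′} e₃)
      where same-dist : ∀ {u v u′ v′} → distance u v ≡ distance u′ v′ → dist N u v ≡ dist N u′ v′
            same-dist {u} {v} {u′} {v′} e =
              ≡.trans (≡.sym (toℕ-distance u v)) (≡.trans (≡.cong toℕ e) (toℕ-distance u′ v′))
    Invariant⇒value-at inv x y z (no ¬realised) = ⊥-elim (¬realised (x , y , z , ≡.refl , ≡.refl , ≡.refl))

    Invariant⇒combo : ∀ {v} → Invariant v → v ≋ combo D (coefficients v)
    Invariant⇒combo {v} inv x y z = begin
      v x y z                         ≈⟨ Invariant⇒value-at inv x y z (realised? h i j) ⟩
      coefficients v h i j            ≈⟨ combo-at (coefficients v) x y z ⟨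
      combo D (coefficients v) x y z  ∎
      where
      h = distance y z
      i = distance x z
      j = distance x y

    combo-independent : ∀ co → combo D co ≋ 𝟎 → ∀ h i j → ¬ (P (toℕ h) (toℕ i) (toℕ j) ≋ 𝟎) → co h i j ≈ 0#
    combo-independent co combo≋𝟎 h i j P≉𝟎 with P≉𝟎⇒realised h i j P≉𝟎
    ... | x , y , z , ≡.refl , ≡.refl , ≡.refl = trans (sym (combo-at co x y z)) (combo≋𝟎 x y z)

    Λ-P : IsField F → (∀ {h k} → h ≤ D → k ≤ D → θ* h ≈ θ* k → h ≡ k) →
          ∀ {h i j} → h ≤ D → i ≤ D → j ≤ D → Λ (P h i j)
    Λ-P fld θ*-injective {h} {i} {j} h≤D i≤D j≤D = Λ-resp restrictions≋P
      (Λ-restrict fld θ*-injective (λ x y z → dist N y z) (λ x y z → dist≤D y z) (λ _ _ _ _ → refl) Λ-A*⁽¹⁾ h≤D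
      (Λ-restrict fld θ*-injective (λ x y z → dist N x z) (λ x y z → dist≤D x z) (λ _ _ _ _ → refl) Λ-A*⁽²⁾ i≤D
      (Λ-restrict fld θ*-injective (λ x y z → dist N x y) (λ x y z → dist≤D x y) (λ _ _ _ _ → refl) Λ-A*⁽³⁾ j≤D
        Λ-𝟏)))
      where
      restrictions≋P : ∀ x y z →
        [ dist N y z ≡ᵇ h ] * ([ dist N x z ≡ᵇ i ] * ([ dist N x y ≡ᵇ j ] * 1#)) ≈ P h i j x y z
      restrictions≋P x y z = begin
        [ b₁ ] * ([ b₂ ] * ([ b₃ ] * 1#)) ≈⟨ *-congˡ (*-congˡ (*-identityʳ [ b₃ ])) ⟩
        [ b₁ ] * ([ b₂ ] * [ b₃ ])        ≈⟨ *-congˡ ([∧] b₂ b₃) ⟨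
        [ b₁ ] * [ b₂ ∧ b₃ ]              ≈⟨ [∧] b₁ (b₂ ∧ b₃) ⟨
        [ b₁ ∧ b₂ ∧ b₃ ]                  ∎
        where
        b₁ = dist N y z ≡ᵇ h
        b₂ = dist N x z ≡ᵇ i
        b₃ = dist N x y ≡ᵇ j

open import Defs
open import Data.Nat using (ℕ; _≤_; _*_; suc)
open import Data.Fin using (toℕ)
open import Data.Sum using (_⊎_)
open import Data.Product using (_×_)
open import Relation.Binary.PropositionalEquality using (_≡_)
open import Algebra.Bundles using (CommutativeRing)
open import Data.Nat as ℕ using (_<_; z≤n; s≤s)
import Data.Nat.Properties as ℕ
open import Data.Fin.Properties using (toℕ<n)
open import Data.Sum using ([_,_]′)
open import Data.Product using (_,_)
open import Relation.Binary.PropositionalEquality using (sym; subst)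

corollary6p5 : ∀ {c ℓ} (F : CommutativeRing c ℓ) → IsField F → CharZero F →
    (D N : ℕ) → 2 ≤ D → (N ≡ 2 * D ⊎ N ≡ suc (2 * D)) →
    (ζ : CommutativeRing.Carrier F) → PrimitiveRoot F N ζ →
    let open Cycle F N ζ in
    IsBasisOfΛ D
    × (∀ (h i j : I D) →
         (A*⁽¹⁾ (P (toℕ h) (toℕ i) (toℕ j)) ≋ (θ* (toℕ h) ⊛ P (toℕ h) (toℕ i) (toℕ j)))
         × (A*⁽²⁾ (P (toℕ h) (toℕ i) (toℕ j)) ≋ (θ* (toℕ i) ⊛ P (toℕ h) (toℕ i) (toℕ j)))
         × (A*⁽³⁾ (P (toℕ h) (toℕ i) (toℕ j)) ≋ (θ* (toℕ j) ⊛ P (toℕ h) (toℕ i) (toℕ j))))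
corollary6p5 F fld _ D N 2≤D N≡2D⊎2D+1 ζ prim =
  ( (λ h i j _ → Λ-P fld (θ*-injective 2D≤N) (≤D h) (≤D i) (≤D j))
  , (λ v v∈Λ → coefficients v , Invariant⇒combo (Λ⇒Invariant 2<N v∈Λ))
  , combo-independent )
  , λ h i j → A*⁽¹⁾-P (toℕ h) (toℕ i) (toℕ j) , A*⁽²⁾-P (toℕ h) (toℕ i) (toℕ j) , A*⁽³⁾-P (toℕ h) (toℕ i) (toℕ j)
  where
  2D≤N : 2 * D ≤ N
  2D≤N = [ (λ N≡2D → ℕ.≤-reflexive (sym N≡2D))
         , (λ N≡2D+1 → subst (2 * D ≤_) (sym N≡2D+1) (ℕ.n≤1+n (2 * D))) ]′ N≡2D⊎2D+1
  N≤2D+1 : N ≤ suc (2 * D)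
  N≤2D+1 = [ (λ N≡2D → subst (_≤ suc (2 * D)) (sym N≡2D) (ℕ.n≤1+n (2 * D)))
           , ℕ.≤-reflexive ]′ N≡2D⊎2D+1
  2<N : 2 < N
  2<N = ℕ.<-≤-trans (s≤s (s≤s (s≤s z≤n))) (ℕ.≤-trans (ℕ.*-monoʳ-≤ 2 2≤D) 2D≤N)
  instance
    N≢0 : ℕ.NonZero N
    N≢0 = ℕ.>-nonZero (ℕ.<-trans (s≤s z≤n) 2<N)
  open Fundamental F N ζ
  open Profiles D N≤2D+1
  open RootsOfUnity F fld N ζ prim using (θ*-injective)
  ≤D : (h : Cycle.I F N ζ D) → toℕ h ≤ D
  ≤D h = ℕ.s≤s⁻¹ (toℕ<n h)
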